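{- A quadrilateral tiling of an orientable compact connected surface without boundary is (pentagonally) subdivisible if and only if its underlying graph is bipartite. The underlying graph of a subdivisible quadrilateral tiling of a non-orientable compact connected surface without boundary is never bipartite.
   Context: A tiling of a compact connected surface without boundary is a graph embedded in the surface such that the complementary regions (tiles) are open disks; tilings are edge-to-edge, every vertex has degree at least $3$, every tile has at least $3$ edges, and tiles may be degenerate (their boundary need not be a simple closed curve). A quadrilateral tiling has $4$ edges along the boundary of each tile. A simple pentagonal subdivision of a quadrilateral tiling is obtained by placing a new vertex at the middle point of every edge and, inside each tile, joining by an arc the middle points of one of the two pairs of opposite edges of the tile, such that the middle point of each edge is used exactly once. A quadrilateral tiling is (pentagonally) subdivisible if it admits a simple pentagonal subdivision. -}

module Defs where

-- Tilings of compact connected surfaces without boundary, encoded as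
-- (finite, connected) combinatorial maps in the flag formalism
-- (Jones–Singerman / Lins).  A flag is an incident triple
-- (vertex, edge, tile); finiteness of the flag set = compactness.
--   σ₀ : swaps the vertex of a flag (other end of the edge side),
--   σ₁ : swaps the edge (other edge at that vertex in that tile),
--   σ₂ : swaps the tile (other side of that edge).
-- Vertices = ⟨σ₁,σ₂⟩-orbits, edges = ⟨σ₀,σ₂⟩-orbits,
-- tiles = ⟨σ₀,σ₁⟩-orbits, sides of tiles = ⟨σ₀⟩-orbits.

open import Data.Nat using (ℕ; suc)
open import Data.Fin using (Fin)
open import Data.Bool using (Bool)
open import Data.Product using (Σ; _×_)
open import Data.Sum using (_⊎_)
open import Relation.Binary.PropositionalEquality using (_≡_; _≢_)
open import Relation.Binary.Construct.Closure.ReflexiveTransitive using (Star)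

iter : {A : Set} → ℕ → (A → A) → A → A
iter ℕ.zero    f x = x
iter (ℕ.suc k) f x = f (iter k f x)

record QuadTiling (n : ℕ) : Set where
  field
    σ₀ σ₁ σ₂ : Fin n → Fin n
    σ₀-invol : ∀ x → σ₀ (σ₀ x) ≡ x
    σ₁-invol : ∀ x → σ₁ (σ₁ x) ≡ x
    σ₂-invol : ∀ x → σ₂ (σ₂ x) ≡ x
    σ₀-free  : ∀ x → σ₀ x ≢ x
    σ₁-free  : ∀ x → σ₁ x ≢ x
    σ₂-free  : ∀ x → σ₂ x ≢ x
    -- σ₀σ₂ is a fixed-point-free involution (each edge has exactly 4 flags)
    σ₀σ₂-comm : ∀ x → σ₀ (σ₂ x) ≡ σ₂ (σ₀ x)
    σ₀σ₂-free : ∀ x → σ₀ (σ₂ x) ≢ x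
    inhabited : Fin n
    connected : ∀ x y → Star (λ a b → (b ≡ σ₀ a) ⊎ (b ≡ σ₁ a) ⊎ (b ≡ σ₂ a)) x y
    -- quadrilateral: every tile has exactly 4 edges along its boundary
    -- (the rotation σ₁σ₀ has order exactly 4 on every flag)
    quad-4   : ∀ x → iter 4 (λ y → σ₁ (σ₀ y)) x ≡ x
    quad-not2 : ∀ x → iter 2 (λ y → σ₁ (σ₀ y)) x ≢ x
    -- every vertex has degree at least 3
    -- (the rotation σ₂σ₁ has order ≥ 3 on every flag)
    deg-not1 : ∀ x → iter 1 (λ y → σ₂ (σ₁ y)) x ≢ x
    deg-not2 : ∀ x → iter 2 (λ y → σ₂ (σ₁ y)) x ≢ x

module _ {n : ℕ} (M : QuadTiling n) where
  open QuadTiling M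

  Orientable : Set
  Orientable = Σ (Fin n → Bool) λ o →
    (∀ x → o (σ₀ x) ≢ o x) × (∀ x → o (σ₁ x) ≢ o x) × (∀ x → o (σ₂ x) ≢ o x)

  -- Underlying graph bipartite: a 2-colouring of the vertices
  -- (a colouring of flags constant on vertex orbits ⟨σ₁,σ₂⟩) such that
  -- the two ends of every edge (x and σ₀ x) get different colours.
  Bipartite : Set
  Bipartite = Σ (Fin n → Bool) λ c →
    (∀ x → c (σ₁ x) ≡ c x) × (∀ x → c (σ₂ x) ≡ c x) × (∀ x → c (σ₀ x) ≢ c x)

  -- Simple pentagonal subdivision: j marks, for each side of each tile
  -- (side = {x, σ₀ x}), whether its midpoint is joined by the arc inside
  -- that tile.  In each tile exactly one of the two pairs of opposite sides
  -- is joined: adjacent sides (x, σ₁ x) have different marks and opposite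
  -- sides (x, (σ₁σ₀)² x) equal marks.  Each edge has two sides (x, σ₂ x);
  -- its midpoint is used exactly once: exactly one of them is joined.
  Subdivisible : Set
  Subdivisible = Σ (Fin n → Bool) λ j →
    (∀ x → j (σ₀ x) ≡ j x) ×
    (∀ x → j (σ₁ x) ≢ j x) ×
    (∀ x → j (iter 2 (λ y → σ₁ (σ₀ y)) x) ≡ j x) ×
    (∀ x → j (σ₂ x) ≢ j x)

module Submission where

-- Proof idea.  All three structures of the statement are Boolean
-- colourings of the flags, each characterised by which of the
-- involutions σ₀, σ₁, σ₂ PRESERVE it and which REVERSE it:
--
--                    σ₀         σ₁         σ₂
--   orientation o    reverses   reverses   reverses
--   bipartition c    reverses   preserves  preserves
--   subdivision j    preserves  reverses   reverses
--
-- The pointwise xor of two colourings is preserved by a map when the map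
-- behaves the same way on both, and reversed otherwise.  Reading the table
-- row-wise: o xor j is a bipartition, o xor c is a subdivision and j xor c
-- is an orientation.  This gives both directions of the equivalence on
-- orientable surfaces, and shows that on a non-orientable surface a
-- subdivision and a bipartition cannot coexist.  The only extra condition,
-- that opposite sides of a tile carry equal marks, holds because the tile
-- rotation σ₁σ₀ reverses o xor c, so its square preserves it.

open import Defs
open import Data.Nat using (ℕ)
open import Data.Product using (_×_; _,_)
open import Function.Base using (_∘_)
open import Function.Bundles using (_⇔_; mk⇔)
open import Relation.Nullary using (¬_)
open import Data.Bool using (Bool; not; _xor_)
open import Data.Bool.Properties
  using (not-¬; ¬-not; not-distribˡ-xor; not-distribʳ-xor; not-involutive; xor-comm)
open import Relation.Binary.PropositionalEquality
  using (_≡_; _≢_; refl; sym; trans; cong; cong₂; ≢-sym; module ≡-Reasoning)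

not-≢-self : ∀ (b : Bool) → not b ≢ b
not-≢-self b = ≢-sym (not-¬ refl)

xor-changeˡ : ∀ {a a′ b b′ : Bool} → a′ ≢ a → b′ ≡ b → a′ xor b′ ≢ a xor b
xor-changeˡ {a} {a′} {b} {b′} a′≢a refl eq = not-≢-self (a xor b) not-ab≡ab
  where
  not-ab≡ab : not (a xor b) ≡ a xor b
  not-ab≡ab = begin
    not (a xor b)  ≡⟨ not-distribˡ-xor a b ⟩
    not a xor b    ≡⟨ cong (_xor b) (sym (¬-not a′≢a)) ⟩
    a′ xor b       ≡⟨ eq ⟩
    a xor b        ∎
    where open ≡-Reasoning

xor-changeʳ : ∀ {a a′ b b′ : Bool} → a′ ≡ a → b′ ≢ b → a′ xor b′ ≢ a xor b
xor-changeʳ {a} {a′} {b} {b′} a′≡a b′≢b eq =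
  xor-changeˡ b′≢b a′≡a (trans (xor-comm b′ a′) (trans eq (xor-comm a b)))

xor-change-both : ∀ {a a′ b b′ : Bool} → a′ ≢ a → b′ ≢ b → a′ xor b′ ≡ a xor b
xor-change-both {a} {a′} {b} {b′} a′≢a b′≢b = begin
  a′ xor b′            ≡⟨ cong₂ _xor_ (¬-not a′≢a) (¬-not b′≢b) ⟩
  not a xor not b      ≡⟨ sym (not-distribˡ-xor a (not b)) ⟩
  not (a xor not b)    ≡⟨ cong not (sym (not-distribʳ-xor a b)) ⟩
  not (not (a xor b))  ≡⟨ not-involutive (a xor b) ⟩
  a xor b              ∎
  where open ≡-Reasoning

change-twice : ∀ {a b c : Bool} → a ≢ b → b ≢ c → a ≡ c
change-twice a≢b b≢c = trans (¬-not a≢b) (sym (¬-not (≢-sym b≢c)))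

module _ {A : Set} where

  Preserves : (A → A) → (A → Bool) → Set
  Preserves s f = ∀ x → f (s x) ≡ f x

  Reverses : (A → A) → (A → Bool) → Set
  Reverses s f = ∀ x → f (s x) ≢ f x

  _⊕_ : (A → Bool) → (A → Bool) → A → Bool
  (f ⊕ g) x = f x xor g x

  reverses-⊕-preserves : ∀ {s f g} → Reverses s f → Preserves s g → Reverses s (f ⊕ g)
  reverses-⊕-preserves rf pg x = xor-changeˡ (rf x) (pg x)

  preserves-⊕-reverses : ∀ {s f g} → Preserves s f → Reverses s g → Reverses s (f ⊕ g)
  preserves-⊕-reverses pf rg x = xor-changeʳ (pf x) (rg x)

  reverses-⊕-reverses : ∀ {s f g} → Reverses s f → Reverses s g → Preserves s (f ⊕ g)
  reverses-⊕-reverses rf rg x = xor-change-both (rf x) (rg x)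

  reverses-∘-preserves : ∀ {s t f} → Reverses t f → Preserves s f → Reverses (t ∘ s) f
  reverses-∘-preserves {s} rt ps x eq = rt (s x) (trans eq (sym (ps x)))

  reverses-∘-reverses : ∀ {s t f} → Reverses t f → Reverses s f → Preserves (t ∘ s) f
  reverses-∘-reverses {s} rt rs x = change-twice (rt (s x)) (rs x)

module _ {n : ℕ} (M : QuadTiling n) where
  open QuadTiling M

  subdivisible⇒bipartite : Orientable M → Subdivisible M → Bipartite M
  subdivisible⇒bipartite (o , o₀ , o₁ , o₂) (j , j₀ , j₁ , _ , j₂) =
    o ⊕ j , reverses-⊕-reverses o₁ j₁ , reverses-⊕-reverses o₂ j₂
          , reverses-⊕-preserves o₀ j₀

  bipartite⇒subdivisible : Orientable M → Bipartite M → Subdivisible M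
  bipartite⇒subdivisible (o , o₀ , o₁ , o₂) (c , c₁ , c₂ , c₀) =
    o ⊕ c , j₀ , j₁ , reverses-∘-reverses rotation-reverses rotation-reverses
          , reverses-⊕-preserves o₂ c₂
    where
    j₀ : Preserves σ₀ (o ⊕ c)
    j₀ = reverses-⊕-reverses o₀ c₀
    j₁ : Reverses σ₁ (o ⊕ c)
    j₁ = reverses-⊕-preserves o₁ c₁
    rotation-reverses : Reverses (σ₁ ∘ σ₀) (o ⊕ c)
    rotation-reverses = reverses-∘-preserves j₁ j₀

  subdivisible⇒bipartite⇒orientable : Subdivisible M → Bipartite M → Orientable M
  subdivisible⇒bipartite⇒orientable (j , j₀ , j₁ , _ , j₂) (c , c₁ , c₂ , c₀) =
    j ⊕ c , preserves-⊕-reverses j₀ c₀ , reverses-⊕-preserves j₁ c₁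
          , reverses-⊕-preserves j₂ c₂

proposition2p4 : ∀ {n : ℕ} (M : QuadTiling n) →
    (Orientable M → (Subdivisible M ⇔ Bipartite M)) ×
    (¬ Orientable M → Subdivisible M → ¬ Bipartite M)
proposition2p4 M =
  (λ or → mk⇔ (subdivisible⇒bipartite M or) (bipartite⇒subdivisible M or)) ,
  (λ ¬or sub bip → ¬or (subdivisible⇒bipartite⇒orientable M sub bip))
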